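{- Let $G=(V,E)$ be a connected graph with $n$ vertices, let $\tau$ be a set of types with $|\tau|=k>1$, let $f:\tau\to\mathbb{Q}_{\ge1}$ be a fitness function, and let $\alpha\in\tau_{\max}(f)$. Let $f^+=f(\alpha)$ and $f^*=\max\{f(j): j\in\tau\setminus\{\alpha\}\}$, and suppose $f^*<f^+$. Let $M$ be the Moran process $M(G,\tau,f,M_0)$ and let $t$ be a non-negative integer such that $V_\alpha(t)\notin\{\emptyset,V\}$. Then $\mathbb{E}(\Psi_\alpha(M_{t+1})-\Psi_\alpha(M_t))>(1-f^*/f^+)/n^3$ (the expectation being over the transition from $M_t$ to $M_{t+1}$, given $M_t$).
   Context: $N(v)$ is the neighbourhood of $v$ in $G$, $d(v)=|N(v)|$. $\tau_{\max}(f)=\{i: f(i)=\max_j f(j)\}$. States are functions $S:V\to\tau$; $S|_{v\to w}$ equals $S$ except that $w$ gets type $S(v)$. The Moran process $M(G,\tau,f,M_0)$ is the Markov chain on states started at $M_0$ in which, given $M_t$, a vertex $v$ is chosen with probability $f(M_t(v))/\sum_uf(M_t(u))$, then a uniformly random $w\in N(v)$, and $M_{t+1}=M_t|_{v\to w}$. $V_j(t)=\{v: M_t(v)=j\}$. The potential $\Psi_j$ maps a state $S$ to $\Psi_j(S)=\sum_{v: S(v)=j}1/d(v)$. -}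

module Defs where

open import Data.Nat as ℕ using (ℕ; zero; suc)
open import Data.Fin using (Fin)
open import Data.Fin.Properties using () renaming (_≟_ to _≟ᶠ_)
open import Data.Bool using (Bool; true; false; if_then_else_)
open import Data.Integer using (+_)
open import Data.Rational
open import Data.Rational.Properties using () renaming (_≟_ to _≟ℚ_)
open import Data.List using (List; foldr; map; filter; allFin)
open import Relation.Nullary using (Dec; yes; no; ¬_)
open import Relation.Binary.PropositionalEquality using (_≡_; _≢_)

Σ[_] : ∀ n → (Fin n → ℚ) → ℚ
Σ[ zero ] g = 0ℚ
Σ[ suc n ] g = g Fin.zero + Σ[ n ] (λ i → g (Fin.suc i))
  where import Data.Fin as Fin

record Graph (n : ℕ) : Set where
  field
    adj   : Fin n → Fin n → Bool
    sym   : ∀ u v → adj u v ≡ adj v u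
    irrefl : ∀ v → adj v v ≡ false

open Graph public

data Reach {n : ℕ} (G : Graph n) : Fin n → Fin n → Set where
  here : ∀ {v} → Reach G v v
  step : ∀ {u v w} → adj G u v ≡ true → Reach G v w → Reach G u w

Connected : ∀ {n} → Graph n → Set
Connected G = ∀ u v → Reach G u v

[_]ℚ : Bool → ℚ
[ true ]ℚ = 1ℚ
[ false ]ℚ = 0ℚ

deg : ∀ {n} → Graph n → Fin n → ℕ
deg {n} G v = count n (λ w → adj G v w)
  where
  count : ∀ m → (Fin m → Bool) → ℕ
  count zero b = 0
  count (suc m) b = (if b Fin.zero then 1 else 0) ℕ.+ count m (λ i → b (Fin.suc i))
    where import Data.Fin as Fin

-- 1/m for a natural m (convention 1/0 = 0; never used since connected graphs
-- with ≥ 2 vertices have all degrees ≥ 1).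
invℕ : ℕ → ℚ
invℕ zero = 0ℚ
invℕ (suc m) = + 1 / suc m

-- 1/p for a rational p (convention 1/0 = 0; only applied to positive total fitness).
invℚ : ℚ → ℚ
invℚ p with p ≟ℚ 0ℚ
... | yes _ = 0ℚ
... | no p≢0 = 1/_ p {{≢-nonZero p≢0}}

State : ℕ → ℕ → Set
State n k = Fin n → Fin k

_∣_⇒_ : ∀ {n k} → State n k → Fin n → Fin n → State n k
(S ∣ v ⇒ w) u with u ≟ᶠ w
... | yes _ = S v
... | no _ = S u

eqᶠ : ∀ {k} → Fin k → Fin k → Bool
eqᶠ i j with i ≟ᶠ j
... | yes _ = true
... | no _ = false

Ψ : ∀ {n k} → Graph n → Fin k → State n k → ℚ
Ψ {n} G j S = Σ[ n ] (λ v → [ eqᶠ (S v) j ]ℚ * invℕ (deg G v))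

totalFitness : ∀ {n k} → (Fin k → ℚ) → State n k → ℚ
totalFitness {n} f S = Σ[ n ] (λ u → f (S u))

-- Probability that the Moran step from S picks reproducer v and then offspring target w:
-- f(S v)/Σ_u f(S u) · [w ∈ N(v)]/d(v).
stepProb : ∀ {n k} → Graph n → (Fin k → ℚ) → State n k → Fin n → Fin n → ℚ
stepProb G f S v w =
  (f (S v) * invℚ (totalFitness f S)) * ([ adj G v w ]ℚ * invℕ (deg G v))

expectedDrift : ∀ {n k} → Graph n → (Fin k → ℚ) → Fin k → State n k → ℚ
expectedDrift {n} G f α S =
  Σ[ n ] (λ v → Σ[ n ] (λ w →
    stepProb G f S v w * (Ψ G α (S ∣ v ⇒ w) - Ψ G α S)))

-- f* = max { f(j) : j ∈ τ ∖ {α} }  (the list is nonempty when k > 1, and f ≥ 1,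
-- so the base value 0 of the fold does not affect the result)
fStar : ∀ {k} → (Fin k → ℚ) → Fin k → ℚ
fStar {k} f α = foldr _⊔_ 0ℚ (map f (filter (λ j → Relation.Nullary.¬? (j ≟ᶠ α)) (allFin k)))
  where import Relation.Nullary

NoneOf : ∀ {n k} → State n k → Fin k → Set
NoneOf S j = ∀ v → S v ≢ j

AllOf : ∀ {n k} → State n k → Fin k → Set
AllOf S j = ∀ v → S v ≡ j

{-# OPTIONS --safe #-}
-- A move in which v reproduces onto w changes Ψ_α by (χ v − χ w)/d(w), where χ indicates type α,
-- so the drift is Σ_{v,w} K(v,w) f(S v) (χ v − χ w) for the symmetric weight
-- K(v,w) = [v ~ w] / (F d(v) d(w)), F being the total fitness. Pairing (v,w) with (w,v) rewrites it
-- as Σ K(v,w) χ v (1 − χ w) (f(S v) − f(S w)), a sum of non-negative terms because α is fittest.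
-- Connectivity yields an edge a ~ b with S a = α ≠ S b, whose term is at least
-- K(a,b) (f⁺ − f*) = (1 − f*/f⁺) f⁺ K(a,b); and f⁺ K(a,b) > 1/n³ since F < n f⁺ and degrees are ≤ n.
module Submission where

open import Defs
open import Data.Nat as ℕ using (ℕ; _^_; zero; suc)
import Data.Nat.Properties as ℕP
open import Data.Fin as Fin using (Fin)
open import Data.Fin.Properties using (any?; ¬∀⟶∃¬; suc-injective) renaming (_≟_ to _≟ᶠ_)
import Data.Integer as ℤ
import Data.Integer.Properties as ℤP
open import Data.Rational
  using (ℚ; _≤_; _<_; _-_; _*_; 1ℚ; 0ℚ; _+_; _/_; _⊔_; toℚᵘ; positive; nonNegative; ≢-nonZero)
open import Data.Rational.Properties
import Data.Rational.Unnormalised as ℚᵘ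
import Data.Rational.Unnormalised.Properties as ℚᵘP
open import Data.Rational.Solver using (module +-*-Solver)
open import Data.Bool using (Bool; true; false)
open import Data.List using (List; _∷_; foldr)
open import Data.List.Membership.Propositional using (_∈_)
open import Data.List.Relation.Unary.Any using (here; there)
open import Data.List.Membership.Propositional.Properties using (∈-map⁺; ∈-filter⁺; ∈-allFin)
open import Data.Product using (∃₂; _×_; _,_)
open import Data.Empty using (⊥-elim)
open import Function using (_∘_)
open import Relation.Binary.PropositionalEquality
  using (_≡_; _≢_; refl; trans; cong; cong₂; subst; module ≡-Reasoning)
import Relation.Binary.PropositionalEquality as ≡
open import Relation.Nullary using (¬_; ¬?; yes; no)

open +-*-Solver

fromℕ : ℕ → ℚ
fromℕ n = ℤ.+ n / 1

toℚᵘ-fromℕ : ∀ n → toℚᵘ (fromℕ n) ℚᵘ.≃ ℚᵘ.mkℚᵘ (ℤ.+ n) 0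
toℚᵘ-fromℕ n = toℚᵘ-fromℚᵘ (ℚᵘ.mkℚᵘ (ℤ.+ n) 0)

fromℕ-+ : ∀ m n → fromℕ (m ℕ.+ n) ≡ fromℕ m + fromℕ n
fromℕ-+ m n = toℚᵘ-injective (begin
  toℚᵘ (fromℕ (m ℕ.+ n))
    ≈⟨ toℚᵘ-fromℕ (m ℕ.+ n) ⟩
  ℚᵘ.mkℚᵘ (ℤ.+ (m ℕ.+ n)) 0
    ≈⟨ ℚᵘ.*≡* (cong (ℤ._* (ℤ.+ 1)) numerators) ⟩
  ℚᵘ.mkℚᵘ (ℤ.+ m) 0 ℚᵘ.+ ℚᵘ.mkℚᵘ (ℤ.+ n) 0
    ≈⟨ ℚᵘP.≃-sym (ℚᵘP.+-cong (toℚᵘ-fromℕ m) (toℚᵘ-fromℕ n)) ⟩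
  toℚᵘ (fromℕ m) ℚᵘ.+ toℚᵘ (fromℕ n)
    ≈⟨ ℚᵘP.≃-sym (toℚᵘ-homo-+ (fromℕ m) (fromℕ n)) ⟩
  toℚᵘ (fromℕ m + fromℕ n) ∎)
  where
  open ℚᵘP.≃-Reasoning
  numerators : ℤ.+ (m ℕ.+ n) ≡ (ℤ.+ m) ℤ.* (ℤ.+ 1) ℤ.+ (ℤ.+ n) ℤ.* (ℤ.+ 1)
  numerators = trans (ℤP.pos-+ m n) (≡.sym (cong₂ ℤ._+_ (ℤP.*-identityʳ (ℤ.+ m)) (ℤP.*-identityʳ (ℤ.+ n))))

fromℕ-* : ∀ m n → fromℕ (m ℕ.* n) ≡ fromℕ m * fromℕ n
fromℕ-* m n = toℚᵘ-injective (begin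
  toℚᵘ (fromℕ (m ℕ.* n))
    ≈⟨ toℚᵘ-fromℕ (m ℕ.* n) ⟩
  ℚᵘ.mkℚᵘ (ℤ.+ (m ℕ.* n)) 0
    ≈⟨ ℚᵘ.*≡* (cong (ℤ._* (ℤ.+ 1)) (ℤP.pos-* m n)) ⟩
  ℚᵘ.mkℚᵘ (ℤ.+ m) 0 ℚᵘ.* ℚᵘ.mkℚᵘ (ℤ.+ n) 0
    ≈⟨ ℚᵘP.≃-sym (ℚᵘP.*-cong (toℚᵘ-fromℕ m) (toℚᵘ-fromℕ n)) ⟩
  toℚᵘ (fromℕ m) ℚᵘ.* toℚᵘ (fromℕ n)
    ≈⟨ ℚᵘP.≃-sym (toℚᵘ-homo-* (fromℕ m) (fromℕ n)) ⟩
  toℚᵘ (fromℕ m * fromℕ n) ∎)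
  where open ℚᵘP.≃-Reasoning

fromℕ-nonNeg : ∀ n → 0ℚ ≤ fromℕ n
fromℕ-nonNeg n = nonNegative⁻¹ (fromℕ n) {{normalize-nonNeg n 1}}

fromℕ-pos : ∀ {n} → 1 ℕ.≤ n → 0ℚ < fromℕ n
fromℕ-pos {suc n} _ = positive⁻¹ (fromℕ (suc n)) {{normalize-pos (suc n) 1}}

fromℕ-mono-≤ : ∀ {m n} → m ℕ.≤ n → fromℕ m ≤ fromℕ n
fromℕ-mono-≤ {m} {n} m≤n = begin
  fromℕ m                    ≡⟨ ≡.sym (+-identityʳ (fromℕ m)) ⟩
  fromℕ m + 0ℚ               ≤⟨ +-monoʳ-≤ (fromℕ m) (fromℕ-nonNeg (n ℕ.∸ m)) ⟩
  fromℕ m + fromℕ (n ℕ.∸ m)  ≡⟨ ≡.sym (fromℕ-+ m (n ℕ.∸ m)) ⟩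
  fromℕ (m ℕ.+ (n ℕ.∸ m))    ≡⟨ cong fromℕ (ℕP.m+[n∸m]≡n m≤n) ⟩
  fromℕ n                    ∎
  where open ≤-Reasoning

invℕ-*-fromℕ : ∀ {m} → 1 ℕ.≤ m → invℕ m * fromℕ m ≡ 1ℚ
invℕ-*-fromℕ {suc m} _ = toℚᵘ-injective (begin
  toℚᵘ (invℕ (suc m) * fromℕ (suc m))
    ≈⟨ toℚᵘ-homo-* (invℕ (suc m)) (fromℕ (suc m)) ⟩
  toℚᵘ (invℕ (suc m)) ℚᵘ.* toℚᵘ (fromℕ (suc m))
    ≈⟨ ℚᵘP.*-cong (toℚᵘ-fromℚᵘ (ℚᵘ.mkℚᵘ (ℤ.+ 1) m)) (toℚᵘ-fromℕ (suc m)) ⟩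
  ℚᵘ.mkℚᵘ (ℤ.+ 1) m ℚᵘ.* ℚᵘ.mkℚᵘ (ℤ.+ suc m) 0
    ≈⟨ ℚᵘ.*≡* cross ⟩
  ℚᵘ.mkℚᵘ (ℤ.+ 1) 0 ∎)
  where
  open ℚᵘP.≃-Reasoning
  cross : ((ℤ.+ 1) ℤ.* (ℤ.+ suc m)) ℤ.* (ℤ.+ 1) ≡ (ℤ.+ 1) ℤ.* (ℤ.+ (suc m ℕ.* 1))
  cross = trans (ℤP.*-identityʳ _) (cong ((ℤ.+ 1) ℤ.*_) (cong ℤ.+_ (≡.sym (ℕP.*-identityʳ (suc m)))))

invℕ-nonNeg : ∀ m → 0ℚ ≤ invℕ m
invℕ-nonNeg zero = ≤-refl
invℕ-nonNeg (suc m) = nonNegative⁻¹ (invℕ (suc m)) {{normalize-nonNeg 1 (suc m)}}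

*-nonNeg : ∀ {p q} → 0ℚ ≤ p → 0ℚ ≤ q → 0ℚ ≤ p * q
*-nonNeg {p} {q} 0≤p 0≤q =
  nonNegative⁻¹ (p * q) {{nonNeg*nonNeg⇒nonNeg p {{nonNegative 0≤p}} q {{nonNegative 0≤q}}}}

*-pos : ∀ {p q} → 0ℚ < p → 0ℚ < q → 0ℚ < p * q
*-pos {p} {q} 0<p 0<q = positive⁻¹ (p * q) {{pos*pos⇒pos p {{positive 0<p}} q {{positive 0<q}}}}

*≡1⇒pos : ∀ {y p} → 0ℚ < p → y * p ≡ 1ℚ → 0ℚ < y
*≡1⇒pos {y} {p} 0<p yp≡1 = *-cancelʳ-<-nonNeg p {{nonNegative (<⇒≤ 0<p)}} (begin-strict
  0ℚ * p  ≡⟨ *-zeroˡ p ⟩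
  0ℚ      <⟨ positive⁻¹ 1ℚ ⟩
  1ℚ      ≡⟨ ≡.sym yp≡1 ⟩
  y * p   ∎)
  where open ≤-Reasoning

*≡1-antimono-< : ∀ {y z p q} → 0ℚ < p → p < q → y * p ≡ 1ℚ → z * q ≡ 1ℚ → z < y
*≡1-antimono-< {y} {z} {p} {q} 0<p p<q yp≡1 zq≡1 =
  *-cancelʳ-<-nonNeg q {{nonNegative (<⇒≤ (<-trans 0<p p<q))}} (begin-strict
    z * q  ≡⟨ trans zq≡1 (≡.sym yp≡1) ⟩
    y * p  <⟨ *-monoʳ-<-pos y {{positive (*≡1⇒pos {y} 0<p yp≡1)}} p<q ⟩
    y * q  ∎)
  where open ≤-Reasoning

*≡1-* : ∀ {y z p q} → y * p ≡ 1ℚ → z * q ≡ 1ℚ → (y * z) * (p * q) ≡ 1ℚ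
*≡1-* {y} {z} {p} {q} yp≡1 zq≡1 = begin
  (y * z) * (p * q)  ≡⟨ solve 4 (λ y z p q → (y :* z) :* (p :* q) := (y :* p) :* (z :* q)) refl y z p q ⟩
  (y * p) * (z * q)  ≡⟨ cong₂ _*_ yp≡1 zq≡1 ⟩
  1ℚ * 1ℚ            ≡⟨ *-identityˡ 1ℚ ⟩
  1ℚ                 ∎
  where open ≡-Reasoning

invℚ-*-self : ∀ {p} → 0ℚ < p → invℚ p * p ≡ 1ℚ
invℚ-*-self {p} 0<p with p ≟ 0ℚ
... | yes p≡0 = ⊥-elim (<-irrefl (≡.sym p≡0) 0<p)
... | no p≢0 = *-inverseˡ p {{≢-nonZero p≢0}}

invℚ-pos : ∀ {p} → 0ℚ < p → 0ℚ < invℚ p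
invℚ-pos {p} 0<p = *≡1⇒pos {invℚ p} 0<p (invℚ-*-self 0<p)

p≤q⇒0≤q-p : ∀ {p q} → p ≤ q → 0ℚ ≤ q - p
p≤q⇒0≤q-p {p} {q} p≤q = subst (_≤ q - p) (+-inverseʳ p) (+-monoˡ-≤ (- p) p≤q)
  where open Data.Rational using (-_)

p<q⇒0<q-p : ∀ {p q} → p < q → 0ℚ < q - p
p<q⇒0<q-p {p} {q} p<q = subst (_< q - p) (+-inverseʳ p) (+-monoˡ-< (- p) p<q)
  where open Data.Rational using (-_)

invℚ-*-< : ∀ {g F N} → 0ℚ < g → F < N * g → invℚ g * F < N
invℚ-*-< {g} {F} {N} 0<g F<Ng = begin-strict
  invℚ g * F          <⟨ *-monoʳ-<-pos (invℚ g) {{positive (invℚ-pos 0<g)}} F<Ng ⟩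
  invℚ g * (N * g)    ≡⟨ solve 3 (λ y N g → y :* (N :* g) := N :* (y :* g)) refl (invℚ g) N g ⟩
  N * (invℚ g * g)    ≡⟨ cong (N *_) (invℚ-*-self 0<g) ⟩
  N * 1ℚ              ≡⟨ *-identityʳ N ⟩
  N                   ∎
  where open ≤-Reasoning

1-q/g-pos : ∀ {q g} → 0ℚ < g → q < g → 0ℚ < 1ℚ - q * invℚ g
1-q/g-pos {q} {g} 0<g q<g = p<q⇒0<q-p (begin-strict
  q * invℚ g  <⟨ *-monoˡ-<-pos (invℚ g) {{positive (invℚ-pos 0<g)}} q<g ⟩
  g * invℚ g  ≡⟨ trans (*-comm g (invℚ g)) (invℚ-*-self 0<g) ⟩
  1ℚ          ∎)
  where open ≤-Reasoning

[1-q/g]*g*K≡K*[g-q] : ∀ {q g} K → 0ℚ < g → (1ℚ - q * invℚ g) * (g * K) ≡ K * (g - q)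
[1-q/g]*g*K≡K*[g-q] {q} {g} K 0<g = begin
  (1ℚ - q * invℚ g) * (g * K)
    ≡⟨ solve 4 (λ q y g K → (con 1ℚ :- q :* y) :* (g :* K) := K :* (g :- q :* (y :* g))) refl q (invℚ g) g K ⟩
  K * (g - q * (invℚ g * g))     ≡⟨ cong (λ e → K * (g - q * e)) (invℚ-*-self 0<g) ⟩
  K * (g - q * 1ℚ)               ≡⟨ cong (λ e → K * (g - e)) (*-identityʳ q) ⟩
  K * (g - q)                    ∎
  where open ≡-Reasoning

*-fromℕ-<-cube : ∀ {q n d e} → q < fromℕ n → 1 ℕ.≤ d → d ℕ.≤ n → 1 ℕ.≤ e → e ℕ.≤ n →
  q * (fromℕ d * fromℕ e) < fromℕ (n ^ 3)
*-fromℕ-<-cube {q} {n} {d} {e} q<N 1≤d d≤n 1≤e e≤n = begin-strict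
  q * (fromℕ d * fromℕ e)  <⟨ *-monoˡ-<-pos (fromℕ d * fromℕ e) {{positive 0<de}} q<N ⟩
  N * (fromℕ d * fromℕ e)  ≤⟨ *-monoˡ-≤-nonNeg N {{0≤N}} (*-monoʳ-≤-nonNeg (fromℕ e) {{0≤e}} (fromℕ-mono-≤ d≤n)) ⟩
  N * (N * fromℕ e)        ≤⟨ *-monoˡ-≤-nonNeg N {{0≤N}} (*-monoˡ-≤-nonNeg N {{0≤N}} (fromℕ-mono-≤ e≤n)) ⟩
  N * (N * N)              ≡⟨ cong (λ m → N * (N * m)) (≡.sym (*-identityʳ N)) ⟩
  N * (N * (N * 1ℚ))       ≡⟨ ≡.sym cube ⟩
  fromℕ (n ^ 3)            ∎
  where
  open ≤-Reasoning
  N = fromℕ n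
  0≤N = nonNegative (fromℕ-nonNeg n)
  0≤e = nonNegative (fromℕ-nonNeg e)
  cube : fromℕ (n ^ 3) ≡ N * (N * (N * 1ℚ))
  cube = trans (fromℕ-* n _) (cong (N *_) (trans (fromℕ-* n _) (cong (N *_) (fromℕ-* n 1))))
  0<de : 0ℚ < fromℕ d * fromℕ e
  0<de = *-pos (fromℕ-pos 1≤d) (fromℕ-pos 1≤e)

cube-<-ratio : ∀ {n g F d e} → 0ℚ < g → 0ℚ < F → F < fromℕ n * g →
  1 ℕ.≤ d → d ℕ.≤ n → 1 ℕ.≤ e → e ℕ.≤ n → invℕ (n ^ 3) < (g * invℚ F) * (invℕ d * invℕ e)
cube-<-ratio {n} {g} {F} {d} {e} 0<g 0<F F<Ng 1≤d d≤n 1≤e e≤n =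
  *≡1-antimono-< 0<p (*-fromℕ-<-cube (invℚ-*-< 0<g F<Ng) 1≤d d≤n 1≤e e≤n)
    reciprocal (invℕ-*-fromℕ (ℕP.m^n>0 n 3))
  where
  instance
    n≢0 : ℕ.NonZero n
    n≢0 = ℕ.>-nonZero (ℕP.≤-trans 1≤d d≤n)
  reciprocal : ((g * invℚ F) * (invℕ d * invℕ e)) * ((invℚ g * F) * (fromℕ d * fromℕ e)) ≡ 1ℚ
  reciprocal = *≡1-* {g * invℚ F} {invℕ d * invℕ e}
    (*≡1-* {g} {invℚ F} (trans (*-comm g (invℚ g)) (invℚ-*-self 0<g)) (invℚ-*-self 0<F))
    (*≡1-* {invℕ d} {invℕ e} (invℕ-*-fromℕ 1≤d) (invℕ-*-fromℕ 1≤e))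
  0<p : 0ℚ < (invℚ g * F) * (fromℕ d * fromℕ e)
  0<p = *-pos (*-pos (invℚ-pos 0<g) 0<F) (*-pos (fromℕ-pos 1≤d) (fromℕ-pos 1≤e))

Σ-cong : ∀ n {g h : Fin n → ℚ} → (∀ i → g i ≡ h i) → Σ[ n ] g ≡ Σ[ n ] h
Σ-cong zero    g≡h = refl
Σ-cong (suc n) g≡h = cong₂ _+_ (g≡h Fin.zero) (Σ-cong n (g≡h ∘ Fin.suc))

Σ-zero : ∀ n → Σ[ n ] (λ _ → 0ℚ) ≡ 0ℚ
Σ-zero zero    = refl
Σ-zero (suc n) = trans (+-identityˡ _) (Σ-zero n)

Σ-+ : ∀ n (g h : Fin n → ℚ) → Σ[ n ] (λ i → g i + h i) ≡ Σ[ n ] g + Σ[ n ] h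
Σ-+ zero    g h = ≡.sym (+-identityʳ 0ℚ)
Σ-+ (suc n) g h = trans (cong ((g Fin.zero + h Fin.zero) +_) (Σ-+ n (g ∘ Fin.suc) (h ∘ Fin.suc)))
  (solve 4 (λ a b c d → (a :+ b) :+ (c :+ d) := (a :+ c) :+ (b :+ d)) refl
    (g Fin.zero) (h Fin.zero) (Σ[ n ] (g ∘ Fin.suc)) (Σ[ n ] (h ∘ Fin.suc)))

Σ-sub : ∀ n (g h : Fin n → ℚ) → Σ[ n ] (λ i → g i - h i) ≡ Σ[ n ] g - Σ[ n ] h
Σ-sub zero    g h = refl
Σ-sub (suc n) g h = trans (cong ((g Fin.zero - h Fin.zero) +_) (Σ-sub n (g ∘ Fin.suc) (h ∘ Fin.suc)))
  (solve 4 (λ a b c d → (a :- b) :+ (c :- d) := (a :+ c) :- (b :+ d)) refl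
    (g Fin.zero) (h Fin.zero) (Σ[ n ] (g ∘ Fin.suc)) (Σ[ n ] (h ∘ Fin.suc)))

Σ-swap : ∀ m l (g : Fin m → Fin l → ℚ) →
  Σ[ m ] (λ v → Σ[ l ] (g v)) ≡ Σ[ l ] (λ w → Σ[ m ] (λ v → g v w))
Σ-swap zero    l g = ≡.sym (Σ-zero l)
Σ-swap (suc m) l g = trans (cong (Σ[ l ] (g Fin.zero) +_) (Σ-swap m l (g ∘ Fin.suc)))
  (≡.sym (Σ-+ l (g Fin.zero) (λ w → Σ[ m ] (λ v → g (Fin.suc v) w))))

Σ-const : ∀ n c → Σ[ n ] (λ _ → c) ≡ fromℕ n * c
Σ-const zero    c = ≡.sym (*-zeroˡ c)
Σ-const (suc n) c = begin
  c + Σ[ n ] (λ _ → c)      ≡⟨ cong (c +_) (Σ-const n c) ⟩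
  c + fromℕ n * c           ≡⟨ solve 2 (λ c m → c :+ m :* c := (con 1ℚ :+ m) :* c) refl c (fromℕ n) ⟩
  (1ℚ + fromℕ n) * c        ≡⟨ cong (_* c) (≡.sym (fromℕ-+ 1 n)) ⟩
  fromℕ (suc n) * c         ∎
  where open ≡-Reasoning

Σ-mono-≤ : ∀ n {g h : Fin n → ℚ} → (∀ i → g i ≤ h i) → Σ[ n ] g ≤ Σ[ n ] h
Σ-mono-≤ zero    g≤h = ≤-refl
Σ-mono-≤ (suc n) g≤h = +-mono-≤ (g≤h Fin.zero) (Σ-mono-≤ n (g≤h ∘ Fin.suc))

Σ-mono-< : ∀ n {g h : Fin n → ℚ} → (∀ i → g i ≤ h i) → ∀ j → g j < h j → Σ[ n ] g < Σ[ n ] h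
Σ-mono-< (suc n) g≤h Fin.zero    gj<hj = +-mono-<-≤ gj<hj (Σ-mono-≤ n (g≤h ∘ Fin.suc))
Σ-mono-< (suc n) g≤h (Fin.suc j) gj<hj = +-mono-≤-< (g≤h Fin.zero) (Σ-mono-< n (g≤h ∘ Fin.suc) j gj<hj)

Σ-nonNeg : ∀ n {g : Fin n → ℚ} → (∀ i → 0ℚ ≤ g i) → 0ℚ ≤ Σ[ n ] g
Σ-nonNeg n {g} 0≤g = subst (_≤ Σ[ n ] g) (Σ-zero n) (Σ-mono-≤ n 0≤g)

term≤Σ : ∀ n {g : Fin n → ℚ} → (∀ i → 0ℚ ≤ g i) → ∀ j → g j ≤ Σ[ n ] g
term≤Σ (suc n) {g} 0≤g Fin.zero = begin
  g Fin.zero                          ≡⟨ ≡.sym (+-identityʳ _) ⟩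
  g Fin.zero + 0ℚ                     ≤⟨ +-monoʳ-≤ (g Fin.zero) (Σ-nonNeg n (0≤g ∘ Fin.suc)) ⟩
  g Fin.zero + Σ[ n ] (g ∘ Fin.suc)   ∎
  where open ≤-Reasoning
term≤Σ (suc n) {g} 0≤g (Fin.suc j) = begin
  g (Fin.suc j)                       ≡⟨ ≡.sym (+-identityˡ _) ⟩
  0ℚ + g (Fin.suc j)                  ≤⟨ +-mono-≤ (0≤g Fin.zero) (term≤Σ n (0≤g ∘ Fin.suc) j) ⟩
  g Fin.zero + Σ[ n ] (g ∘ Fin.suc)   ∎
  where open ≤-Reasoning

Σ-differ-at : ∀ n {g h : Fin n → ℚ} (w : Fin n) → (∀ u → u ≢ w → g u ≡ h u) →
  Σ[ n ] g - Σ[ n ] h ≡ g w - h w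
Σ-differ-at (suc n) {g} {h} Fin.zero g≡h = begin
  (g Fin.zero + Σ[ n ] (g ∘ Fin.suc)) - (h Fin.zero + Σ[ n ] (h ∘ Fin.suc))
    ≡⟨ cong (λ s → (g Fin.zero + s) - (h Fin.zero + Σ[ n ] (h ∘ Fin.suc))) tails-agree ⟩
  (g Fin.zero + Σ[ n ] (h ∘ Fin.suc)) - (h Fin.zero + Σ[ n ] (h ∘ Fin.suc))
    ≡⟨ solve 3 (λ a b s → (a :+ s) :- (b :+ s) := a :- b) refl (g Fin.zero) (h Fin.zero) (Σ[ n ] (h ∘ Fin.suc)) ⟩
  g Fin.zero - h Fin.zero ∎
  where
  open ≡-Reasoning
  tails-agree : Σ[ n ] (g ∘ Fin.suc) ≡ Σ[ n ] (h ∘ Fin.suc)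
  tails-agree = Σ-cong n (λ u → g≡h (Fin.suc u) λ ())
Σ-differ-at (suc n) {g} {h} (Fin.suc w) g≡h = begin
  (g Fin.zero + Σ[ n ] (g ∘ Fin.suc)) - (h Fin.zero + Σ[ n ] (h ∘ Fin.suc))
    ≡⟨ cong (λ a → (a + Σ[ n ] (g ∘ Fin.suc)) - (h Fin.zero + Σ[ n ] (h ∘ Fin.suc))) (g≡h Fin.zero λ ()) ⟩
  (h Fin.zero + Σ[ n ] (g ∘ Fin.suc)) - (h Fin.zero + Σ[ n ] (h ∘ Fin.suc))
    ≡⟨ solve 3 (λ a s t → (a :+ s) :- (a :+ t) := s :- t) refl
         (h Fin.zero) (Σ[ n ] (g ∘ Fin.suc)) (Σ[ n ] (h ∘ Fin.suc)) ⟩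
  Σ[ n ] (g ∘ Fin.suc) - Σ[ n ] (h ∘ Fin.suc)
    ≡⟨ Σ-differ-at n w (λ u u≢w → g≡h (Fin.suc u) (u≢w ∘ suc-injective)) ⟩
  g (Fin.suc w) - h (Fin.suc w) ∎
  where open ≡-Reasoning

Σ²[_] : ∀ n → (Fin n → Fin n → ℚ) → ℚ
Σ²[ n ] g = Σ[ n ] (λ v → Σ[ n ] (g v))

Σ²-cong : ∀ n {g h : Fin n → Fin n → ℚ} → (∀ v w → g v w ≡ h v w) → Σ²[ n ] g ≡ Σ²[ n ] h
Σ²-cong n g≡h = Σ-cong n (λ v → Σ-cong n (g≡h v))

Σ²-sub : ∀ n (g h : Fin n → Fin n → ℚ) → Σ²[ n ] (λ v w → g v w - h v w) ≡ Σ²[ n ] g - Σ²[ n ] h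
Σ²-sub n g h = trans (Σ-cong n (λ v → Σ-sub n (g v) (h v))) (Σ-sub n (λ v → Σ[ n ] (g v)) (λ v → Σ[ n ] (h v)))

term≤Σ² : ∀ n {g : Fin n → Fin n → ℚ} → (∀ v w → 0ℚ ≤ g v w) → ∀ a b → g a b ≤ Σ²[ n ] g
term≤Σ² n 0≤g a b =
  ≤-trans (term≤Σ n (0≤g a) b) (term≤Σ n (λ v → Σ-nonNeg n (0≤g v)) a)

-- The counting function inside `deg` is local to its definition; it is reached for an
-- arbitrary predicate `b` as the degree of the centre of the star whose leaves are `b`.
star : ∀ {n} → (Fin n → Bool) → Graph (suc n)
star {n} b = record { adj = edge ; sym = edge-sym ; irrefl = edge-irrefl }
  where
  edge : Fin (suc n) → Fin (suc n) → Bool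
  edge Fin.zero    Fin.zero    = false
  edge Fin.zero    (Fin.suc j) = b j
  edge (Fin.suc i) Fin.zero    = b i
  edge (Fin.suc i) (Fin.suc j) = false
  edge-sym : ∀ u v → edge u v ≡ edge v u
  edge-sym Fin.zero    Fin.zero    = refl
  edge-sym Fin.zero    (Fin.suc j) = refl
  edge-sym (Fin.suc i) Fin.zero    = refl
  edge-sym (Fin.suc i) (Fin.suc j) = refl
  edge-irrefl : ∀ v → edge v v ≡ false
  edge-irrefl Fin.zero    = refl
  edge-irrefl (Fin.suc v) = refl

count : ∀ n → (Fin n → Bool) → ℕ
count n b = deg (star b) Fin.zero

count-≤ : ∀ n b → count n b ℕ.≤ n
count-≤ zero    b = ℕ.z≤n
count-≤ (suc n) b with b Fin.zero
... | true  = ℕ.s≤s (count-≤ n (b ∘ Fin.suc))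
... | false = ℕP.m≤n⇒m≤1+n (count-≤ n (b ∘ Fin.suc))

count-pos : ∀ n b j → b j ≡ true → 1 ℕ.≤ count n b
count-pos (suc n) b Fin.zero    bj≡true rewrite bj≡true = ℕ.s≤s ℕ.z≤n
count-pos (suc n) b (Fin.suc j) bj≡true with b Fin.zero
... | true  = ℕ.s≤s ℕ.z≤n
... | false = count-pos n (b ∘ Fin.suc) j bj≡true

deg-≤ : ∀ {n} (G : Graph n) v → deg G v ℕ.≤ n
deg-≤ {n} G v = count-≤ n (adj G v)

deg-pos : ∀ {n} (G : Graph n) {v w} → adj G v w ≡ true → 1 ℕ.≤ deg G v
deg-pos {n} G {v} {w} = count-pos n (adj G v) w

[]ℚ-nonNeg : ∀ b → 0ℚ ≤ [ b ]ℚ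
[]ℚ-nonNeg true  = <⇒≤ (positive⁻¹ 1ℚ)
[]ℚ-nonNeg false = ≤-refl

[]ℚ-gap-nonNeg : ∀ b c d → (b ≡ true → 0ℚ ≤ d) → 0ℚ ≤ [ b ]ℚ * (1ℚ - [ c ]ℚ) * d
[]ℚ-gap-nonNeg true true d _ =
  ≤-reflexive (≡.sym (solve 1 (λ d → con 1ℚ :* (con 1ℚ :- con 1ℚ) :* d := con 0ℚ) refl d))
[]ℚ-gap-nonNeg true false d 0≤d =
  subst (0ℚ ≤_) (≡.sym (solve 1 (λ d → con 1ℚ :* (con 1ℚ :- con 0ℚ) :* d := d) refl d)) (0≤d refl)
[]ℚ-gap-nonNeg false c d _ =
  ≤-reflexive (≡.sym (solve 2 (λ e d → con 0ℚ :* (con 1ℚ :- e) :* d := con 0ℚ) refl [ c ]ℚ d))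

eqᶠ-≡ : ∀ {k} {i j : Fin k} → i ≡ j → eqᶠ i j ≡ true
eqᶠ-≡ {i = i} {j} i≡j with i ≟ᶠ j
... | yes _   = refl
... | no  i≢j = ⊥-elim (i≢j i≡j)

eqᶠ-≢ : ∀ {k} {i j : Fin k} → i ≢ j → eqᶠ i j ≡ false
eqᶠ-≢ {i = i} {j} i≢j with i ≟ᶠ j
... | yes i≡j = ⊥-elim (i≢j i≡j)
... | no  _   = refl

eqᶠ-true⇒≡ : ∀ {k} {i j : Fin k} → eqᶠ i j ≡ true → i ≡ j
eqᶠ-true⇒≡ {i = i} {j} eq with i ≟ᶠ j
eqᶠ-true⇒≡ _  | yes i≡j = i≡j
eqᶠ-true⇒≡ () | no  _

update-at : ∀ {n k} (S : State n k) v w → (S ∣ v ⇒ w) w ≡ S v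
update-at S v w with w ≟ᶠ w
... | yes _   = refl
... | no  w≢w = ⊥-elim (w≢w refl)

update-off : ∀ {n k} (S : State n k) v w u → u ≢ w → (S ∣ v ⇒ w) u ≡ S u
update-off S v w u u≢w with u ≟ᶠ w
... | yes u≡w = ⊥-elim (u≢w u≡w)
... | no  _   = refl

Ψ-update : ∀ {n k} (G : Graph n) (α : Fin k) (S : State n k) v w →
  Ψ G α (S ∣ v ⇒ w) - Ψ G α S ≡ ([ eqᶠ (S v) α ]ℚ - [ eqᶠ (S w) α ]ℚ) * invℕ (deg G w)
Ψ-update {n} {k} G α S v w = begin
  Ψ G α (S ∣ v ⇒ w) - Ψ G α S
    ≡⟨ Σ-differ-at n w (λ u u≢w → cong (weight u) (update-off S v w u u≢w)) ⟩
  weight w ((S ∣ v ⇒ w) w) - weight w (S w)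
    ≡⟨ cong (λ j → weight w j - weight w (S w)) (update-at S v w) ⟩
  weight w (S v) - weight w (S w)
    ≡⟨ solve 3 (λ a b d → a :* d :- b :* d := (a :- b) :* d) refl
         [ eqᶠ (S v) α ]ℚ [ eqᶠ (S w) α ]ℚ (invℕ (deg G w)) ⟩
  ([ eqᶠ (S v) α ]ℚ - [ eqᶠ (S w) α ]ℚ) * invℕ (deg G w) ∎
  where
  open ≡-Reasoning
  weight : Fin n → Fin k → ℚ
  weight u j = [ eqᶠ j α ]ℚ * invℕ (deg G u)

≤-foldr-⊔ : ∀ {p : ℚ} {ps : List ℚ} → p ∈ ps → p ≤ foldr _⊔_ 0ℚ ps
≤-foldr-⊔ {p} {_ ∷ ps} (here refl) = p≤p⊔q p (foldr _⊔_ 0ℚ ps)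
≤-foldr-⊔ {p} {q ∷ _} (there p∈ps) = p≤q⇒p≤r⊔q q (≤-foldr-⊔ p∈ps)

≤-fStar : ∀ {k} (f : Fin k → ℚ) α {j} → j ≢ α → f j ≤ fStar f α
≤-fStar {k} f α {j} j≢α =
  ≤-foldr-⊔ (∈-map⁺ f (∈-filter⁺ (λ i → ¬? (i ≟ᶠ α)) (∈-allFin j) j≢α))

boundary-edge : ∀ {n k} (G : Graph n) (S : State n k) (α : Fin k) {u w} → Reach G u w → S u ≡ α → S w ≢ α →
  ∃₂ λ a b → adj G a b ≡ true × S a ≡ α × S b ≢ α
boundary-edge G S α here Su≡α Sw≢α = ⊥-elim (Sw≢α Su≡α)
boundary-edge G S α (step {u} {v} u~v v⇝w) Su≡α Sw≢α with S v ≟ᶠ α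
... | yes Sv≡α = boundary-edge G S α v⇝w Sv≡α Sw≢α
... | no  Sv≢α = u , v , u~v , Su≡α , Sv≢α

mixed-boundary-edge : ∀ {n k} (G : Graph n) → Connected G → (S : State n k) (α : Fin k) →
  ¬ NoneOf S α → ¬ AllOf S α → ∃₂ λ a b → adj G a b ≡ true × S a ≡ α × S b ≢ α
mixed-boundary-edge {n} G connected S α some notAll
  with any? (λ v → S v ≟ᶠ α)
... | no  none = ⊥-elim (some λ v Sv≡α → none (v , Sv≡α))
... | yes (u , Su≡α) with ¬∀⟶∃¬ n (λ v → S v ≡ α) (λ v → S v ≟ᶠ α) notAll
...   | w , Sw≢α = boundary-edge G S α (connected u w) Su≡α Sw≢α

Σ²-antisymmetrise : ∀ n (K : Fin n → Fin n → ℚ) (u x : Fin n → ℚ) → (∀ v w → K v w ≡ K w v) →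
  Σ²[ n ] (λ v w → K v w * (u v * (x v - x w))) ≡
  Σ²[ n ] (λ v w → K v w * (x v * (1ℚ - x w) * (u v - u w)))
Σ²-antisymmetrise n K u x K-sym = begin
  Σ²[ n ] (λ v w → K v w * (u v * (x v - x w)))     ≡⟨ Σ²-cong n split ⟩
  Σ²[ n ] (λ v w → T v w * u v - T w v * u v)       ≡⟨ Σ²-sub n _ _ ⟩
  Σ²[ n ] (λ v w → T v w * u v) - Σ²[ n ] (λ v w → T w v * u v)
    ≡⟨ cong (Σ²[ n ] (λ v w → T v w * u v) -_) (Σ-swap n n (λ v w → T w v * u v)) ⟩
  Σ²[ n ] (λ v w → T v w * u v) - Σ²[ n ] (λ v w → T v w * u w)
    ≡⟨ ≡.sym (Σ²-sub n _ _) ⟩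
  Σ²[ n ] (λ v w → T v w * u v - T v w * u w)       ≡⟨ Σ²-cong n merge ⟩
  Σ²[ n ] (λ v w → K v w * (x v * (1ℚ - x w) * (u v - u w))) ∎
  where
  open ≡-Reasoning
  T : Fin n → Fin n → ℚ
  T v w = K v w * (x v * (1ℚ - x w))
  split : ∀ v w → K v w * (u v * (x v - x w)) ≡ T v w * u v - T w v * u v
  split v w = begin
    K v w * (u v * (x v - x w))
      ≡⟨ solve 4 (λ k u a b → k :* (u :* (a :- b))
                           := k :* (a :* (con 1ℚ :- b)) :* u :- k :* (b :* (con 1ℚ :- a)) :* u)
                 refl (K v w) (u v) (x v) (x w) ⟩
    T v w * u v - K v w * (x w * (1ℚ - x v)) * u v
      ≡⟨ cong (λ k → T v w * u v - k * (x w * (1ℚ - x v)) * u v) (K-sym v w) ⟩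
    T v w * u v - T w v * u v ∎
  merge : ∀ v w → T v w * u v - T v w * u w ≡ K v w * (x v * (1ℚ - x w) * (u v - u w))
  merge v w = solve 5 (λ k a b p q → k :* (a :* (con 1ℚ :- b)) :* p :- k :* (a :* (con 1ℚ :- b)) :* q
                                   := k :* (a :* (con 1ℚ :- b) :* (p :- q)))
                refl (K v w) (x v) (x w) (u v) (u w)

module Drift {n k} (G : Graph n) (f : Fin k → ℚ) (α : Fin k) (S : State n k) where

  χ : Fin n → ℚ
  χ v = [ eqᶠ (S v) α ]ℚ

  edgeWeight : Fin n → Fin n → ℚ
  edgeWeight v w = invℚ (totalFitness f S) * ([ adj G v w ]ℚ * (invℕ (deg G v) * invℕ (deg G w)))

  edgeWeight-sym : ∀ v w → edgeWeight v w ≡ edgeWeight w v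
  edgeWeight-sym v w = cong₂ (λ e d → invℚ (totalFitness f S) * ([ e ]ℚ * d))
    (Graph.sym G v w) (*-comm (invℕ (deg G v)) (invℕ (deg G w)))

  edgeWeight-nonNeg : 0ℚ ≤ invℚ (totalFitness f S) → ∀ v w → 0ℚ ≤ edgeWeight v w
  edgeWeight-nonNeg 0≤I v w = *-nonNeg 0≤I
    (*-nonNeg ([]ℚ-nonNeg (adj G v w)) (*-nonNeg (invℕ-nonNeg (deg G v)) (invℕ-nonNeg (deg G w))))

  expectedDrift-antisymmetrised : expectedDrift G f α S ≡
    Σ²[ n ] (λ v w → edgeWeight v w * (χ v * (1ℚ - χ w) * (f (S v) - f (S w))))
  expectedDrift-antisymmetrised =
    trans (Σ²-cong n transition) (Σ²-antisymmetrise n edgeWeight (f ∘ S) χ edgeWeight-sym)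
    where
    transition : ∀ v w → stepProb G f S v w * (Ψ G α (S ∣ v ⇒ w) - Ψ G α S) ≡
      edgeWeight v w * (f (S v) * (χ v - χ w))
    transition v w = trans (cong (stepProb G f S v w *_) (Ψ-update G α S v w))
      (solve 7 (λ p I e dv dw a b → (p :* I) :* (e :* dv) :* ((a :- b) :* dw)
                                    := I :* (e :* (dv :* dw)) :* (p :* (a :- b)))
        refl (f (S v)) (invℚ (totalFitness f S)) [ adj G v w ]ℚ (invℕ (deg G v)) (invℕ (deg G w)) (χ v) (χ w))

  χ-≡ : ∀ {v} → S v ≡ α → χ v ≡ 1ℚ
  χ-≡ = cong [_]ℚ ∘ eqᶠ-≡

  χ-≢ : ∀ {v} → S v ≢ α → χ v ≡ 0ℚ
  χ-≢ = cong [_]ℚ ∘ eqᶠ-≢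

  selection-nonNeg : (∀ j → f j ≤ f α) → ∀ v w → 0ℚ ≤ χ v * (1ℚ - χ w) * (f (S v) - f (S w))
  selection-nonNeg f≤fα v w = []ℚ-gap-nonNeg (eqᶠ (S v) α) (eqᶠ (S w) α) (f (S v) - f (S w))
    (λ v-is-α → p≤q⇒0≤q-p (subst (λ j → f (S w) ≤ f j) (≡.sym (eqᶠ-true⇒≡ v-is-α)) (f≤fα (S w))))

  boundary-selection : ∀ {a b} → S a ≡ α → S b ≢ α →
    χ a * (1ℚ - χ b) * (f (S a) - f (S b)) ≡ f α - f (S b)
  boundary-selection {a} {b} Sa≡α Sb≢α = begin
    χ a * (1ℚ - χ b) * (f (S a) - f (S b))
      ≡⟨ cong₂ (λ c e → c * (1ℚ - e) * (f (S a) - f (S b))) (χ-≡ Sa≡α) (χ-≢ Sb≢α) ⟩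
    1ℚ * (1ℚ - 0ℚ) * (f (S a) - f (S b))
      ≡⟨ solve 1 (λ d → con 1ℚ :* (con 1ℚ :- con 0ℚ) :* d := d) refl (f (S a) - f (S b)) ⟩
    f (S a) - f (S b)
      ≡⟨ cong (λ j → f j - f (S b)) Sa≡α ⟩
    f α - f (S b) ∎
    where open ≡-Reasoning

  expectedDrift-≥-boundary : 0ℚ ≤ invℚ (totalFitness f S) → (∀ j → f j ≤ f α) →
    ∀ {a b} → S a ≡ α → S b ≢ α → edgeWeight a b * (f α - f (S b)) ≤ expectedDrift G f α S
  expectedDrift-≥-boundary 0≤I f≤fα {a} {b} Sa≡α Sb≢α = begin
    edgeWeight a b * (f α - f (S b))
      ≡⟨ cong (edgeWeight a b *_) (≡.sym (boundary-selection Sa≡α Sb≢α)) ⟩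
    edgeWeight a b * (χ a * (1ℚ - χ b) * (f (S a) - f (S b)))
      ≤⟨ term≤Σ² n (λ v w → *-nonNeg (edgeWeight-nonNeg 0≤I v w) (selection-nonNeg f≤fα v w)) a b ⟩
    Σ²[ n ] (λ v w → edgeWeight v w * (χ v * (1ℚ - χ w) * (f (S v) - f (S w))))
      ≡⟨ ≡.sym expectedDrift-antisymmetrised ⟩
    expectedDrift G f α S ∎
    where open ≤-Reasoning

  totalFitness-pos : (∀ j → 0ℚ < f j) → Fin n → 0ℚ < totalFitness f S
  totalFitness-pos 0<f v = <-≤-trans (0<f (S v)) (term≤Σ n (λ u → <⇒≤ (0<f (S u))) v)

  totalFitness-< : (∀ j → f j ≤ f α) → ∀ {b} → f (S b) < f α → totalFitness f S < fromℕ n * f α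
  totalFitness-< f≤fα {b} fSb<fα =
    <-≤-trans (Σ-mono-< n (λ u → f≤fα (S u)) b fSb<fα) (≤-reflexive (Σ-const n (f α)))

  cube-<-edgeWeight : 0ℚ < f α → 0ℚ < totalFitness f S → totalFitness f S < fromℕ n * f α →
    ∀ {a b} → adj G a b ≡ true → invℕ (n ^ 3) < f α * edgeWeight a b
  cube-<-edgeWeight 0<fα 0<F F<Nfα {a} {b} a~b = begin-strict
    invℕ (n ^ 3)
      <⟨ cube-<-ratio 0<fα 0<F F<Nfα (deg-pos G a~b) (deg-≤ G a) (deg-pos G b~a) (deg-≤ G b) ⟩
    (f α * I) * (invℕ (deg G a) * invℕ (deg G b))
      ≡⟨ solve 4 (λ g I da db → (g :* I) :* (da :* db) := g :* (I :* (con 1ℚ :* (da :* db)))) refl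
           (f α) I (invℕ (deg G a)) (invℕ (deg G b)) ⟩
    f α * (I * (1ℚ * (invℕ (deg G a) * invℕ (deg G b))))
      ≡⟨ cong (λ e → f α * (I * ([ e ]ℚ * (invℕ (deg G a) * invℕ (deg G b))))) (≡.sym a~b) ⟩
    f α * edgeWeight a b ∎
    where
    open ≤-Reasoning
    I = invℚ (totalFitness f S)
    b~a : adj G b a ≡ true
    b~a = trans (Graph.sym G b a) a~b

lemma12 : (n k : ℕ) → 1 ℕ.< k → (G : Graph n) → Connected G →
    (f : Fin k → ℚ) → (∀ i → 1ℚ ≤ f i) →
    (α : Fin k) → (∀ j → f j ≤ f α) →
    fStar f α < f α →
    (S : State n k) → ¬ NoneOf S α → ¬ AllOf S α →
    (1ℚ - fStar f α * invℚ (f α)) * invℕ (n ^ 3) < expectedDrift G f α S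
lemma12 n k _ G connected f 1≤f α f≤fα f*<fα S someα notAllα
  with mixed-boundary-edge G connected S α someα notAllα
... | a , b , a~b , Sa≡α , Sb≢α = begin-strict
  (1ℚ - f* * invℚ (f α)) * invℕ (n ^ 3)
    <⟨ *-monoʳ-<-pos (1ℚ - f* * invℚ (f α)) {{positive (1-q/g-pos 0<fα f*<fα)}}
         (cube-<-edgeWeight 0<fα 0<F F<Nfα a~b) ⟩
  (1ℚ - f* * invℚ (f α)) * (f α * edgeWeight a b)
    ≡⟨ [1-q/g]*g*K≡K*[g-q] (edgeWeight a b) 0<fα ⟩
  edgeWeight a b * (f α - f*)
    ≤⟨ *-monoˡ-≤-nonNeg (edgeWeight a b) {{nonNegative (edgeWeight-nonNeg 0≤I a b)}}
         (+-monoʳ-≤ (f α) (neg-antimono-≤ (≤-fStar f α Sb≢α))) ⟩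
  edgeWeight a b * (f α - f (S b))
    ≤⟨ expectedDrift-≥-boundary 0≤I f≤fα Sa≡α Sb≢α ⟩
  expectedDrift G f α S ∎
  where
  open Drift G f α S
  open ≤-Reasoning
  f* = fStar f α
  0<f : ∀ j → 0ℚ < f j
  0<f j = <-≤-trans (positive⁻¹ 1ℚ) (1≤f j)
  0<fα = 0<f α
  0<F = totalFitness-pos 0<f a
  0≤I = <⇒≤ (invℚ-pos 0<F)
  F<Nfα = totalFitness-< f≤fα (≤-<-trans (≤-fStar f α Sb≢α) f*<fα)
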